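{- Let $\mathrm{Pet}=(\mathrm A\,|\,\mathrm B\,|\,\mathit{readyA}^{\mathit{false}}\,|\,\mathit{readyB}^{\mathit{false}}\,|\,\mathit{turn}^{A})\backslash L$ be the CCSS rendering of Peterson's two-process protocol described in the context (with some fixed bracketing of the parallel compositions). Then every state reachable from $\mathrm{Pet}$ has the form $(P_A\,|\,P_B\,|\,V_1\,|\,V_2\,|\,V_3)\backslash L$ (same bracketing), and there is no reachable state of this form with $P_A\in\{\mathbf{critA}.\overline{w_{\mathit{readyA},\mathit{false}}}.\mathrm A,\ \overline{w_{\mathit{readyA},\mathit{false}}}.\mathrm A\}$ and simultaneously $P_B\in\{\mathbf{critB}.\overline{w_{\mathit{readyB},\mathit{false}}}.\mathrm B,\ \overline{w_{\mathit{readyB},\mathit{false}}}.\mathrm B\}$. That is, the two processes are never simultaneously past their await test and before resetting their ready flag (mutual exclusion).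
   Context: CCS with signals (CCSS): names $\mathcal A$, agent identifiers $\mathcal K$, signals $\mathcal S$; handshake actions $\mathcal H=\mathcal A\cup\{\bar a\mid a\in\mathcal A\}$ with $\bar{\bar a}=a$; actions $Act=\mathcal S\cup\mathcal H\cup\{\tau\}$. Expressions: agent identifiers $A$ (each with a defining equation $A\stackrel{def}{=}P$), prefixes $\alpha.P$, choices $\sum_{i\in I}P_i$ (binary: $P+Q$), parallel composition $P|Q$, restriction $P\backslash L$ ($L\subseteq\mathcal A\cup\mathcal S$), relabelling $P[f]$, signalling $P\,\hat{}\,s$. Semantics: least transition relation $\xrightarrow{\alpha}$ and emission predicate $\curvearrowright s$ closed under: $\alpha.P\xrightarrow{\alpha}P$; $P_j\xrightarrow{\alpha}P'$ ($j\in I$) implies $\sum_iP_i\xrightarrow{\alpha}P'$; $P\xrightarrow{\alpha}P'$ implies $P|Q\xrightarrow{\alpha}P'|Q$; $Q\xrightarrow{\alpha}Q'$ implies $P|Q\xrightarrow{\alpha}P|Q'$; $P\xrightarrow{a}P'$, $Q\xrightarrow{\bar a}Q'$ ($a\in\mathcal H$) imply $P|Q\xrightarrow{\tau}P'|Q'$; $P\xrightarrow{\alpha}P'$ with $\alpha\notin L$ and $\bar\alpha\notin L$ (for $\alpha\in\mathcal H$) implies $P\backslash L\xrightarrow{\alpha}P'\backslash L$; $P\xrightarrow{\alpha}P'$ implies $P[f]\xrightarrow{f(\alpha)}P'[f]$; $P\xrightarrow{\alpha}P'$ and $A\stackrel{def}{=}P$ imply $A\xrightarrow{\alpha}P'$;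 $(P\,\hat{}\,s)\curvearrowright s$; $P\xrightarrow{\alpha}P'$ implies $P\,\hat{}\,s\xrightarrow{\alpha}P'$; $P\curvearrowright s$ implies $(P\,\hat{}\,t)\curvearrowright s$, $(\sum_i P_i)\curvearrowright s$ if some $P_j\curvearrowright s$, $(P|Q)\curvearrowright s$, $(Q|P)\curvearrowright s$, $(P\backslash L)\curvearrowright s$ if $s\notin L$, $P[f]\curvearrowright f(s)$, and $A\curvearrowright s$ if $A\stackrel{def}{=}P$; $P\curvearrowright s$ and $Q\xrightarrow{s}Q'$ imply $P|Q\xrightarrow{\tau}P|Q'$; $P\xrightarrow{s}P'$ and $Q\curvearrowright s$ imply $P|Q\xrightarrow{\tau}P'|Q$. A state is reachable from $P$ if it is obtained from $P$ by a finite sequence of transitions. Peterson's protocol in CCSS: for each shared variable $x\in\{\mathit{readyA},\mathit{readyB},\mathit{turn}\}$ and value $v$, $w_{x,v}\in\mathcal A$ is a handshake name (assignment $x:=v$) and $r_{x,v}\in\mathcal S$ is a signal ($x$ has value $v$). For $x\in\{\mathit{readyA},\mathit{readyB}\}$ and $b\in\{\mathit{true},\mathit{false}\}$: $x^{b}\stackrel{def}{=}(w_{x,\mathit{true}}.x^{\mathit{true}}+w_{x,\mathit{false}}.x^{\mathit{false}})\,\hat{}\,r_{x,b}$; for $c\in\{A,B\}$: $\mathit{turn}^{c}\stackrel{def}{=}(w_{\mathit{turn},A}.\mathit{turn}^{A}+w_{\mathit{turn},B}.\mathit{turn}^{B})\,\hat{}\,r_{\mathit{turn},c}$. The processes are $\mathrm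 A\stackrel{def}{=}\mathbf{noncritA}.\overline{w_{\mathit{readyA},\mathit{true}}}.\overline{w_{\mathit{turn},B}}.(r_{\mathit{readyB},\mathit{false}}.Q_A+r_{\mathit{turn},A}.Q_A)$ with $Q_A=\mathbf{critA}.\overline{w_{\mathit{readyA},\mathit{false}}}.\mathrm A$, and $\mathrm B\stackrel{def}{=}\mathbf{noncritB}.\overline{w_{\mathit{readyB},\mathit{true}}}.\overline{w_{\mathit{turn},A}}.(r_{\mathit{readyA},\mathit{false}}.Q_B+r_{\mathit{turn},B}.Q_B)$ with $Q_B=\mathbf{critB}.\overline{w_{\mathit{readyB},\mathit{false}}}.\mathrm B$, where $\mathbf{noncritA},\mathbf{critA},\mathbf{noncritB},\mathbf{critB}\in\mathcal A$ are further names. $L$ is the set of all names and signals except $\mathbf{noncritA},\mathbf{critA},\mathbf{noncritB},\mathbf{critB}$. -}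

module Defs where

open import Data.Bool using (Bool; true; false; not)
open import Data.Sum using (_⊎_; inj₁; inj₂)
open import Data.Product using (Σ; ∃; _×_; _,_)
open import Data.Unit using (⊤)
open import Relation.Binary.PropositionalEquality using (_≡_)
open import Relation.Binary.Construct.Closure.ReflexiveTransitive using (Star)

-- Generic CCS with signals (CCSS), over names 𝒜, signals 𝒮, agent ids 𝒦.

module CCSS (𝒜 𝒮 𝒦 : Set) where

  -- Act = 𝒮 ∪ ℋ ∪ {τ};  ℋ = 𝒜 ∪ {ā}.  hs a true = a, hs a false = ā.
  data Act : Set where
    sig : 𝒮 → Act
    hs  : 𝒜 → Bool → Act
    τ   : Act

  record Relabel : Set where
    field
      onName : 𝒜 → 𝒜
      onSig  : 𝒮 → 𝒮
  open Relabel public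

  applyR : Relabel → Act → Act
  applyR f (sig s)  = sig (onSig f s)
  applyR f (hs a b) = hs (onName f a) b
  applyR f τ        = τ

  RSet : Set
  RSet = 𝒜 ⊎ 𝒮 → Bool

  -- Side condition of the restriction rule:
  -- α ∉ L, and for α ∈ ℋ also ᾱ ∉ L (both amount to: the underlying name ∉ L).
  Allowed : RSet → Act → Set
  Allowed L (sig s)  = L (inj₂ s) ≡ false
  Allowed L (hs a b) = L (inj₁ a) ≡ false
  Allowed L τ        = ⊤

  infixr 20 _∙_
  infixl 15 _⊕_
  infixr 12 _∥_
  infixl 25 _⌢_

  -- Expressions. Choice ∑_{i∈I} is represented by the empty sum 𝟎 and
  -- binary choice _⊕_.
  data Proc : Set where
    agent : 𝒦 → Proc
    _∙_   : Act → Proc → Proc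
    𝟎     : Proc
    _⊕_   : Proc → Proc → Proc
    _∥_   : Proc → Proc → Proc
    _∖_   : Proc → RSet → Proc
    _⟦_⟧  : Proc → Relabel → Proc
    _⌢_   : Proc → 𝒮 → Proc

  -- Semantics, given the defining equations  A ≝ def A.
  module Semantics (def : 𝒦 → Proc) where

    data _↷_ : Proc → 𝒮 → Set where
      emit    : ∀ {P s} → (P ⌢ s) ↷ s
      sigInh  : ∀ {P s t} → P ↷ s → (P ⌢ t) ↷ s
      sumL    : ∀ {P Q s} → P ↷ s → (P ⊕ Q) ↷ s
      sumR    : ∀ {P Q s} → Q ↷ s → (P ⊕ Q) ↷ s
      parL    : ∀ {P Q s} → P ↷ s → (P ∥ Q) ↷ s
      parR    : ∀ {P Q s} → Q ↷ s → (P ∥ Q) ↷ s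
      res     : ∀ {P L s} → P ↷ s → L (inj₂ s) ≡ false → (P ∖ L) ↷ s
      rel     : ∀ {P f s} → P ↷ s → (P ⟦ f ⟧) ↷ onSig f s
      agentE  : ∀ {A s} → def A ↷ s → agent A ↷ s

    data _─[_]→_ : Proc → Act → Proc → Set where
      pre     : ∀ {α P} → (α ∙ P) ─[ α ]→ P
      sumL    : ∀ {P Q α P'} → P ─[ α ]→ P' → (P ⊕ Q) ─[ α ]→ P'
      sumR    : ∀ {P Q α Q'} → Q ─[ α ]→ Q' → (P ⊕ Q) ─[ α ]→ Q'
      parL    : ∀ {P Q α P'} → P ─[ α ]→ P' → (P ∥ Q) ─[ α ]→ (P' ∥ Q)
      parR    : ∀ {P Q α Q'} → Q ─[ α ]→ Q' → (P ∥ Q) ─[ α ]→ (P ∥ Q')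
      comm    : ∀ {P Q P' Q' a b} → P ─[ hs a b ]→ P' → Q ─[ hs a (not b) ]→ Q' →
                (P ∥ Q) ─[ τ ]→ (P' ∥ Q')
      res     : ∀ {P L α P'} → P ─[ α ]→ P' → Allowed L α → (P ∖ L) ─[ α ]→ (P' ∖ L)
      rel     : ∀ {P f α P'} → P ─[ α ]→ P' → (P ⟦ f ⟧) ─[ applyR f α ]→ (P' ⟦ f ⟧)
      agentT  : ∀ {A α P'} → def A ─[ α ]→ P' → agent A ─[ α ]→ P'
      sigT    : ∀ {P s α P'} → P ─[ α ]→ P' → (P ⌢ s) ─[ α ]→ P'
      sigSyncL : ∀ {P Q Q' s} → P ↷ s → Q ─[ sig s ]→ Q' → (P ∥ Q) ─[ τ ]→ (P ∥ Q')
      sigSyncR : ∀ {P Q P' s} → P ─[ sig s ]→ P' → Q ↷ s → (P ∥ Q) ─[ τ ]→ (P' ∥ Q)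

    Step : Proc → Proc → Set
    Step P P' = ∃ λ α → P ─[ α ]→ P'

    Reachable : Proc → Proc → Set
    Reachable = Star Step

data Who : Set where
  cA cB : Who

data RVar : Set where
  readyA readyB : RVar

data Name : Set where
  wReady  : RVar → Bool → Name
  wTurn   : Who → Name
  noncritA critA noncritB critB : Name

data Signal : Set where
  rReady : RVar → Bool → Signal
  rTurn  : Who → Signal

data AgentId : Set where
  agA agB : AgentId
  readyV  : RVar → Bool → AgentId
  turnV   : Who → AgentId

open CCSS Name Signal AgentId public

nm co : Name → Act
nm a = hs a true
co a = hs a false

sg : Signal → Act
sg = sig

QA : Proc
QA = nm critA ∙ co (wReady readyA false) ∙ agent agA

QB : Proc
QB = nm critB ∙ co (wReady readyB false) ∙ agent agB

petDef : AgentId → Proc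
petDef agA = nm noncritA ∙ co (wReady readyA true) ∙ co (wTurn cB) ∙
             (sg (rReady readyB false) ∙ QA ⊕ sg (rTurn cA) ∙ QA)
petDef agB = nm noncritB ∙ co (wReady readyB true) ∙ co (wTurn cA) ∙
             (sg (rReady readyA false) ∙ QB ⊕ sg (rTurn cB) ∙ QB)
petDef (readyV x b) =
  (nm (wReady x true) ∙ agent (readyV x true) ⊕ nm (wReady x false) ∙ agent (readyV x false))
  ⌢ rReady x b
petDef (turnV c) =
  (nm (wTurn cA) ∙ agent (turnV cA) ⊕ nm (wTurn cB) ∙ agent (turnV cB)) ⌢ rTurn c

open Semantics petDef public

Lpet : RSet
Lpet (inj₁ noncritA) = false
Lpet (inj₁ critA)    = false
Lpet (inj₁ noncritB) = false
Lpet (inj₁ critB)    = false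
Lpet (inj₁ (wReady _ _)) = true
Lpet (inj₁ (wTurn _))    = true
Lpet (inj₂ _)            = true

Config : Proc → Proc → Proc → Proc → Proc → Proc
Config PA PB V₁ V₂ V₃ = (PA ∥ (PB ∥ (V₁ ∥ (V₂ ∥ V₃)))) ∖ Lpet

Pet : Proc
Pet = Config (agent agA) (agent agB) (agent (readyV readyA false))
             (agent (readyV readyB false)) (agent (turnV cA))

data CritA : Proc → Set where
  atCritA   : CritA QA
  atResetA  : CritA (co (wReady readyA false) ∙ agent agA)

data CritB : Proc → Set where
  atCritB   : CritB QB
  atResetB  : CritB (co (wReady readyB false) ∙ agent agB)

-- The proof abstracts the concrete process terms to a finite state machine.
-- Both protocol processes are instances of one parametrised process
-- 'proc c p' (c ∈ {A, B}, p its program counter), and the three shared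
-- variables form a memory 'Mem'.  We first describe the behaviour of each
-- component in isolation: a protocol process performs the local steps of
-- 'Local' and never emits a signal; the memory only accepts assignments
-- and emits the signals for the current values.  From this, every
-- transition of a configuration ⟦ s ⟧ is shown to be a 'Move' of the
-- abstract state s: one process performs a local step, and the memory takes
-- part in it as an assignment, a read, or not at all (simulation lemma).
-- On abstract states we establish Peterson's classical invariant 'Safe':
-- the ready flags reflect the program counters, and a process past its
-- await test while the other one contends holds the turn.  It is preserved
-- by every move and holds initially, so it holds in every reachable state,
-- and it excludes both processes being past their await test at once.

module Submission where

open import Defs
open import Data.Bool using (Bool; true; false; not; T)
open import Data.Unit using (tt)
open import Data.Empty using (⊥; ⊥-elim)
open import Data.Product using (∃; _×_; _,_)
open import Relation.Binary.PropositionalEquality using (_≡_; refl; sym; trans)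
open import Relation.Binary.Construct.Closure.ReflexiveTransitive using (ε; _◅_)

other : Who → Who
other cA = cB
other cB = cA

flagOf : Who → RVar
flagOf cA = readyA
flagOf cB = readyB

agentOf : Who → AgentId
agentOf cA = agA
agentOf cB = agB

noncrit crit : Who → Name
noncrit cA = noncritA
noncrit cB = noncritB
crit cA = critA
crit cB = critB

data Pc : Set where
  idle flagging yielding waiting critical unflagging : Pc

-- The term of process c at program counter p, built from the end of the
-- loop backwards; proc cA and proc cB unfold to the defining equations of
-- A and B (e.g. proc cA critical is QA).
resetTerm criticalTerm awaitTerm : Who → Proc
resetTerm c    = co (wReady (flagOf c) false) ∙ agent (agentOf c)
criticalTerm c = nm (crit c) ∙ resetTerm c
awaitTerm c    = sg (rReady (flagOf (other c)) false) ∙ criticalTerm c ⊕ sg (rTurn c) ∙ criticalTerm c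

proc : Who → Pc → Proc
proc c idle       = agent (agentOf c)
proc c flagging   = co (wReady (flagOf c) true) ∙ co (wTurn (other c)) ∙ awaitTerm c
proc c yielding   = co (wTurn (other c)) ∙ awaitTerm c
proc c waiting    = awaitTerm c
proc c critical   = criticalTerm c
proc c unflagging = resetTerm c

data Local (c : Who) : Pc → Act → Pc → Set where
  noncritStep : Local c idle (nm (noncrit c)) flagging
  setFlag     : Local c flagging (co (wReady (flagOf c) true)) yielding
  setTurn     : Local c yielding (co (wTurn (other c))) waiting
  seeFlagDown : Local c waiting (sg (rReady (flagOf (other c)) false)) critical
  seeTurn     : Local c waiting (sg (rTurn c)) critical
  critStep    : Local c critical (nm (crit c)) unflagging
  clearFlag   : Local c unflagging (co (wReady (flagOf c) false)) idle

local-step : ∀ c {p α Q} → proc c p ─[ α ]→ Q →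
             ∃ λ p' → Local c p α p' × Q ≡ proc c p'
local-step cA {idle} (agentT pre)      = _ , noncritStep , refl
local-step cB {idle} (agentT pre)      = _ , noncritStep , refl
local-step c {flagging} pre            = _ , setFlag , refl
local-step c {yielding} pre            = _ , setTurn , refl
local-step c {waiting} (sumL pre)      = _ , seeFlagDown , refl
local-step c {waiting} (sumR pre)      = _ , seeTurn , refl
local-step c {critical} pre            = _ , critStep , refl
local-step c {unflagging} pre          = _ , clearFlag , refl

silent : ∀ c {p s} → proc c p ↷ s → ⊥
silent cA {idle} (agentE ())
silent cB {idle} (agentE ())
silent c {waiting} (sumL ())
silent c {waiting} (sumR ())

-- A and B never synchronise directly: their only positive handshakes are
-- the visible noncrit/crit actions, which the other never offers.
no-direct-sync : ∀ {p p' q q' a b} →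
                 Local cA p (hs a b) p' → Local cB q (hs a (not b)) q' → ⊥
no-direct-sync noncritStep ()
no-direct-sync setFlag ()
no-direct-sync setTurn ()
no-direct-sync critStep ()
no-direct-sync clearFlag ()

record Mem : Set where
  constructor mem
  field
    aFlag bFlag : Bool
    turn        : Who
open Mem

memory : Mem → Proc
memory m = agent (readyV readyA (aFlag m)) ∥ (agent (readyV readyB (bFlag m)) ∥ agent (turnV (turn m)))

data Assign (m : Mem) : Name → Mem → Set where
  assignA    : ∀ b → Assign m (wReady readyA b) (record m { aFlag = b })
  assignB    : ∀ b → Assign m (wReady readyB b) (record m { bFlag = b })
  assignTurn : ∀ c → Assign m (wTurn c) (record m { turn = c })

data Holds (m : Mem) : Signal → Set where
  holdsA    : Holds m (rReady readyA (aFlag m))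
  holdsB    : Holds m (rReady readyB (bFlag m))
  holdsTurn : Holds m (rTurn (turn m))

data FlagStep (x : RVar) : Act → Proc → Set where
  flagStep : ∀ b → FlagStep x (nm (wReady x b)) (agent (readyV x b))

flag-step : ∀ {x b α Q} → agent (readyV x b) ─[ α ]→ Q → FlagStep x α Q
flag-step (agentT (sigT (sumL pre))) = flagStep true
flag-step (agentT (sigT (sumR pre))) = flagStep false

data TurnStep : Act → Proc → Set where
  turnStep : ∀ c → TurnStep (nm (wTurn c)) (agent (turnV c))

turn-step : ∀ {c α Q} → agent (turnV c) ─[ α ]→ Q → TurnStep α Q
turn-step (agentT (sigT (sumL pre))) = turnStep cA
turn-step (agentT (sigT (sumR pre))) = turnStep cB

flag-emits : ∀ {x b s} → agent (readyV x b) ↷ s → s ≡ rReady x b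
flag-emits (agentE emit) = refl
flag-emits (agentE (sigInh (sumL ())))
flag-emits (agentE (sigInh (sumR ())))

turn-emits : ∀ {c s} → agent (turnV c) ↷ s → s ≡ rTurn c
turn-emits (agentE emit) = refl
turn-emits (agentE (sigInh (sumL ())))
turn-emits (agentE (sigInh (sumR ())))

-- Every transition of the memory is an accepted assignment: the variables
-- only perform positive handshakes, so they cannot interact among themselves.
data MemStep (m : Mem) : Act → Proc → Set where
  memStep : ∀ {n m'} → Assign m n m' → MemStep m (nm n) (memory m')

mem-step : ∀ {m α Q} → memory m ─[ α ]→ Q → MemStep m α Q
mem-step (parL d) with flag-step d
... | flagStep b = memStep (assignA b)
mem-step (parR (parL d)) with flag-step d
... | flagStep b = memStep (assignB b)
mem-step (parR (parR d)) with turn-step d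
... | turnStep c = memStep (assignTurn c)
mem-step (parR (comm d₁ d₂)) with flag-step d₁ | turn-step d₂
... | flagStep _ | ()
mem-step (parR (sigSyncL _ d)) with turn-step d
... | ()
mem-step (parR (sigSyncR d _)) with flag-step d
... | ()
mem-step (comm d₁ (parL d₂)) with flag-step d₁ | flag-step d₂
... | flagStep _ | ()
mem-step (comm d₁ (parR d₂)) with flag-step d₁ | turn-step d₂
... | flagStep _ | ()
mem-step (sigSyncL _ (parL d)) with flag-step d
... | ()
mem-step (sigSyncL _ (parR d)) with turn-step d
... | ()
mem-step (sigSyncR d _) with flag-step d
... | ()

mem-emits : ∀ {m s} → memory m ↷ s → Holds m s
mem-emits (parL e) with flag-emits e
... | refl = holdsA
mem-emits (parR (parL e)) with flag-emits e
... | refl = holdsB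
mem-emits (parR (parR e)) with turn-emits e
... | refl = holdsTurn

assignment-hidden : ∀ {m α Q} → MemStep m α Q → Allowed Lpet α → ⊥
assignment-hidden (memStep (assignA _)) ()
assignment-hidden (memStep (assignB _)) ()
assignment-hidden (memStep (assignTurn _)) ()

data Effect : Act → Mem → Mem → Set where
  visible : ∀ {n m} → Effect (nm n) m m
  write   : ∀ {n m m'} → Assign m n m' → Effect (co n) m m'
  read    : ∀ {s m} → Holds m s → Effect (sg s) m m

isolated : ∀ {c p p' α m} → Local c p α p' → Allowed Lpet α → Effect α m m
isolated noncritStep _ = visible
isolated critStep _    = visible
isolated setFlag ()
isolated setTurn ()
isolated seeFlagDown ()
isolated seeTurn ()
isolated clearFlag ()

writes : ∀ {c p p' a b m Q} → Local c p (hs a b) p' → MemStep m (hs a (not b)) Q →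
         ∃ λ m' → Effect (hs a b) m m' × Q ≡ memory m'
writes setFlag (memStep x)   = _ , write x , refl
writes setTurn (memStep x)   = _ , write x , refl
writes clearFlag (memStep x) = _ , write x , refl

record State : Set where
  constructor ⟨_,_,_⟩
  field
    pcA pcB : Pc
    memOf   : Mem
open State

system : State → Proc
system s = proc cA (pcA s) ∥ (proc cB (pcB s) ∥ memory (memOf s))

⟦_⟧ : State → Proc
⟦ s ⟧ = system s ∖ Lpet

initial : State
initial = ⟨ idle , idle , mem false false cA ⟩

data Move : State → State → Set where
  moveA : ∀ {pa pa' pb m m' α} → Local cA pa α pa' → Effect α m m' →
          Move ⟨ pa , pb , m ⟩ ⟨ pa' , pb , m' ⟩
  moveB : ∀ {pa pb pb' m m' α} → Local cB pb α pb' → Effect α m m' →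
          Move ⟨ pa , pb , m ⟩ ⟨ pa , pb' , m' ⟩

system-step : ∀ {s α Q} → system s ─[ α ]→ Q → Allowed Lpet α →
              ∃ λ s' → Move s s' × Q ≡ system s'
system-step (parL d) ok with local-step cA d
... | _ , l , refl = _ , moveA l (isolated l ok) , refl
system-step (parR (parL d)) ok with local-step cB d
... | _ , l , refl = _ , moveB l (isolated l ok) , refl
system-step (parR (parR d)) ok = ⊥-elim (assignment-hidden (mem-step d) ok)
system-step (comm d₁ (parL d₂)) _ with local-step cA d₁ | local-step cB d₂
... | _ , l₁ , _ | _ , l₂ , _ = ⊥-elim (no-direct-sync l₁ l₂)
system-step (comm d₁ (parR d₂)) _ with local-step cA d₁
... | _ , l , refl with writes l (mem-step d₂)
...   | _ , e , refl = _ , moveA l e , refl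
system-step (parR (comm d₁ d₂)) _ with local-step cB d₁
... | _ , l , refl with writes l (mem-step d₂)
...   | _ , e , refl = _ , moveB l e , refl
system-step (sigSyncL e _) _ = ⊥-elim (silent cA e)
system-step (sigSyncR _ (parL e)) _ = ⊥-elim (silent cB e)
system-step (parR (sigSyncL e _)) _ = ⊥-elim (silent cB e)
system-step (sigSyncR d (parR e)) _ with local-step cA d
... | _ , l , refl = _ , moveA l (read (mem-emits e)) , refl
system-step (parR (sigSyncR d e)) _ with local-step cB d
... | _ , l , refl = _ , moveB l (read (mem-emits e)) , refl

simulate : ∀ {s α Q} → ⟦ s ⟧ ─[ α ]→ Q → ∃ λ s' → Move s s' × Q ≡ ⟦ s' ⟧
simulate (res d ok) with system-step d ok
... | s' , move , refl = s' , move , refl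

-- Phases of the loop: the flag should be raised, the turn has been handed
-- over (the process contends), the await test has been passed.
interested contending passed : Pc → Bool
interested idle     = false
interested flagging = false
interested _        = true
contending waiting    = true
contending critical   = true
contending unflagging = true
contending _          = false
passed critical   = true
passed unflagging = true
passed _          = false

passed⇒contending : ∀ p → T (passed p) → T (contending p)
passed⇒contending critical _   = tt
passed⇒contending unflagging _ = tt

flag-down-not-contending : ∀ p → interested p ≡ false → T (contending p) → ⊥
flag-down-not-contending waiting ()
flag-down-not-contending critical ()
flag-down-not-contending unflagging ()

record Safe (s : State) : Set where
  constructor safe
  field
    aFlag-tracks : aFlag (memOf s) ≡ interested (pcA s)
    bFlag-tracks : bFlag (memOf s) ≡ interested (pcB s)
    aPriority    : T (passed (pcA s)) → T (contending (pcB s)) → turn (memOf s) ≡ cA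
    bPriority    : T (passed (pcB s)) → T (contending (pcA s)) → turn (memOf s) ≡ cB

initial-safe : Safe initial
initial-safe = safe refl refl (λ ()) (λ ())

-- Flag writes keep the flags in step
-- with the program counters; setting the turn to the other process only
-- happens before contending; entering via the turn signal establishes the
-- priority clause directly, and entering via a lowered flag makes it vacuous
-- since a process with a lowered flag does not contend.
preserve : ∀ {s s'} → Safe s → Move s s' → Safe s'
preserve (safe fa fb pa pb) (moveA critStep visible)         = safe fa fb pa pb
preserve (safe fa fb pa pb) (moveB critStep visible)         = safe fa fb pa pb
preserve (safe fa fb _ _)  (moveA noncritStep visible)          = safe fa fb (λ ()) (λ _ ())
preserve (safe fa fb _ _)  (moveB noncritStep visible)          = safe fa fb (λ _ ()) (λ ())
preserve (safe _ fb _ _)   (moveA setFlag (write (assignA _)))  = safe refl fb (λ ()) (λ _ ())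
preserve (safe fa _ _ _)   (moveB setFlag (write (assignB _)))  = safe fa refl (λ _ ()) (λ ())
preserve (safe fa fb _ _)  (moveA setTurn (write (assignTurn _))) = safe fa fb (λ ()) (λ _ _ → refl)
preserve (safe fa fb _ _)  (moveB setTurn (write (assignTurn _))) = safe fa fb (λ _ _ → refl) (λ ())
preserve (safe fa fb _ pb) (moveA seeFlagDown (read holdsB))    =
  safe fa fb (λ _ c → ⊥-elim (flag-down-not-contending _ (sym fb) c)) pb
preserve (safe fa fb pa _) (moveB seeFlagDown (read holdsA))    =
  safe fa fb pa (λ _ c → ⊥-elim (flag-down-not-contending _ (sym fa) c))
preserve (safe fa fb _ pb) (moveA seeTurn (read holdsTurn))     = safe fa fb (λ _ _ → refl) pb
preserve (safe fa fb pa _) (moveB seeTurn (read holdsTurn))     = safe fa fb pa (λ _ _ → refl)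
preserve (safe _ fb _ _)   (moveA clearFlag (write (assignA _))) = safe refl fb (λ ()) (λ _ ())
preserve (safe fa _ _ _)   (moveB clearFlag (write (assignB _))) = safe fa refl (λ _ ()) (λ ())

exclusive : ∀ {s} → Safe s → T (passed (pcA s)) → T (passed (pcB s)) → ⊥
exclusive {s} (safe _ _ pa pb) inA inB
  with trans (sym (pa inA (passed⇒contending (pcB s) inB))) (pb inB (passed⇒contending (pcA s) inA))
... | ()

reachable-safe : ∀ {s P} → Safe s → Reachable ⟦ s ⟧ P → ∃ λ s' → Safe s' × P ≡ ⟦ s' ⟧
reachable-safe inv ε = _ , inv , refl
reachable-safe inv ((_ , d) ◅ rest) with simulate d
... | _ , move , refl = reachable-safe (preserve inv move) rest

critA-passed : ∀ p → CritA (proc cA p) → T (passed p)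
critA-passed critical _   = tt
critA-passed unflagging _ = tt
critA-passed idle ()
critA-passed flagging ()
critA-passed yielding ()

critB-passed : ∀ p → CritB (proc cB p) → T (passed p)
critB-passed critical _   = tt
critB-passed unflagging _ = tt
critB-passed idle ()
critB-passed flagging ()
critB-passed yielding ()

mainTheorem3 : ((P : Proc) → Reachable Pet P →
    ∃ λ PA → ∃ λ PB → ∃ λ V₁ → ∃ λ V₂ → ∃ λ V₃ → P ≡ Config PA PB V₁ V₂ V₃)
    × ((PA PB V₁ V₂ V₃ : Proc) → Reachable Pet (Config PA PB V₁ V₂ V₃) →
    CritA PA → CritB PB → ⊥)
mainTheorem3 = shape , mutual-exclusion
  where
  shape : (P : Proc) → Reachable Pet P →
    ∃ λ PA → ∃ λ PB → ∃ λ V₁ → ∃ λ V₂ → ∃ λ V₃ → P ≡ Config PA PB V₁ V₂ V₃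
  shape P r with reachable-safe initial-safe r
  ... | _ , _ , refl = _ , _ , _ , _ , _ , refl

  mutual-exclusion : (PA PB V₁ V₂ V₃ : Proc) → Reachable Pet (Config PA PB V₁ V₂ V₃) →
    CritA PA → CritB PB → ⊥
  mutual-exclusion _ _ _ _ _ r inA inB with reachable-safe initial-safe r
  ... | s , inv , refl = exclusive inv (critA-passed (pcA s) inA) (critB-passed (pcB s) inB)
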